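{- Let $J$ be an instance of broadcast scheduling with optimal maximum flow time $L^*$, let $\epsilon>0$ be such that $\epsilon L^*$ is a positive integer, and let $J'$ be the modified instance obtained from $J$ by replacing each release time $r_\rho$ by $r'_\rho:=\epsilon L^*\lceil r_\rho/(\epsilon L^*)\rceil$, in which a schedule may transmit only at times that are integer multiples of $\epsilon L^*$ and may transmit at most $\epsilon L^*$ pages at each such time. Then there exists a schedule $\sigma'$ for $J'$ with maximum flow time at most $(1+2\epsilon)L^*$. Moreover, any schedule $\sigma'$ for $J'$ can be converted into a feasible schedule $\sigma$ for $J$ such that $F^{\sigma}_\rho-F^{\sigma'}_\rho\le 2\epsilon L^*$ for every request $\rho$.
   Context: Broadcast scheduling (maximum flow time): a set of unit-sized pages; each request $\rho$ has a non-negative integer release time $r_\rho$ and requests a page $p_\rho$. A feasible schedule for $J$ transmits at most one page at each positive integer time. In a schedule $\sigma$, the completion time $C^\sigma_\rho$ of $\rho$ is the first transmission time of page $p_\rho$ strictly after the (instance's) release time of $\rho$, and the flow time is $F^\sigma_\rho=C^\sigma_\rho-r_\rho$ in $J$ (respectively $C^{\sigma'}_\rho-r'_\rho$ in $J'$). One transmission satisfies all outstanding requests for the transmitted page. $L^*$ is the minimum, over feasible schedules for $J$, of the maximum flow time. -}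

module Defs where

open import Data.Nat using (ℕ; zero; suc; _+_; _*_; _∸_; _<_; _≤_)
open import Data.Nat.DivMod using (_/_)
open import Data.Nat.Divisibility using (_∣_)
open import Data.Maybe using (Maybe; just; nothing)
open import Data.List using (List; []; length)
open import Data.List.Membership.Propositional using (_∈_)
open import Data.Product using (_×_; ∃)
open import Relation.Binary.PropositionalEquality using (_≡_; _≢_)
open import Relation.Nullary using (¬_)

Page : Set
Page = ℕ

record Request : Set where
  constructor req
  field
    release : ℕ
    page    : Page
open Request public

Instance : Set
Instance = List Request

Schedule : Set
Schedule = ℕ → Maybe Page

Feasible : Schedule → Set
Feasible σ = σ 0 ≡ nothing

Tx : Schedule → Page → ℕ → Set
Tx σ p t = σ t ≡ just p

BatchSchedule : Set
BatchSchedule = ℕ → List Page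

FeasibleBatch : ℕ → BatchSchedule → Set
FeasibleBatch k τ =
  (τ 0 ≡ []) × ((t : ℕ) → length (τ t) ≤ k) × ((t : ℕ) → τ t ≢ [] → k ∣ t)

BTx : BatchSchedule → Page → ℕ → Set
BTx τ p t = p ∈ τ t

IsCompletion : (ℕ → Set) → ℕ → ℕ → Set
IsCompletion T r C = (r < C) × T C × ((t : ℕ) → r < t → t < C → ¬ T t)

MaxFlowAtMost : (Page → ℕ → Set) → (Request → ℕ) → Instance → ℕ → Set
MaxFlowAtMost T rel J L =
  (ρ : Request) → ρ ∈ J → ∃ λ C → IsCompletion (T (page ρ)) (rel ρ) C × (C ∸ rel ρ ≤ L)

IsOptimalMaxFlow : Instance → ℕ → Set
IsOptimalMaxFlow J L =
  (∃ λ σ → Feasible σ × MaxFlowAtMost (Tx σ) release J L) ×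
  ((L' : ℕ) (σ : Schedule) → Feasible σ → MaxFlowAtMost (Tx σ) release J L' → L ≤ L')

-- Rounded release time r' = k * ⌈ r / k ⌉ (k > 0; the k = 0 case is unused).

roundUp : ℕ → ℕ → ℕ
roundUp zero    r = r
roundUp (suc k) r = suc k * ((r + k) / suc k)

release' : ℕ → Request → ℕ
release' k ρ = roundUp k (release ρ)

-- Batching: a page sent by σ at time C joins the batch at roundUp C + k, which is a
-- multiple of k in (roundUp r, C + 2k) whenever r < C; so measured from the rounded
-- release times the flow time grows by less than 2k. Unbatching: the at most k pages of
-- the batch at time m k go out one per slot at m k + 1, ..., m k + k, so a request waits
-- at most k beyond its batch, and since roundUp r ≤ r + k, at most 2k in total.
module Submission where

open import Defs
open import Data.Nat using (ℕ; _+_; _*_; _∸_; _<_; _≤_)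
open import Data.Integer using (+_)
open import Data.Rational using (ℚ; 0ℚ; _/_) renaming (_*_ to _*ℚ_; _<_ to _<ℚ_)
open import Data.List.Membership.Propositional using (_∈_)
open import Data.Product using (_×_; ∃)
open import Relation.Binary.PropositionalEquality using (_≡_)

open import Data.Nat using (zero; suc; z≤n; s≤s; z<s)
open import Data.Nat.Properties
open import Data.Nat.DivMod using (_%_; m≡m%n+[m/n]*n; m%n<n; m/n*n≤m; /-monoˡ-≤; [m+kn]%n≡m%n; m<n⇒m%n≡m) renaming (_/_ to _/ℕ_)
open import Data.Nat.Divisibility using (_∣_; _∣?_; divides; ∣-refl; ∣m∣n⇒∣m+n)
open import Data.Nat.Tactic.RingSolver using (solve-∀)
open import Data.Maybe using (Maybe; just; nothing)
open import Data.Maybe.Relation.Unary.Any using () renaming (Any to AnyMaybe; just to just-any)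
import Data.Maybe.Properties as Maybe
open import Data.List using (List; []; _∷_; length; mapMaybe; upTo)
open import Data.List.Properties using (length-mapMaybe; length-upTo; mapMaybe-cong; mapMaybe-nothing)
open import Data.List.Relation.Unary.Any using (here; there)
open import Data.List.Relation.Unary.Any.Properties using (mapMaybe⁺; map⁺; applyUpTo⁺)
open import Data.List.Membership.DecPropositional _≟_ using (_∈?_)
open import Data.Product using (_,_)
open import Data.Sum using (_⊎_; inj₁; inj₂)
open import Data.Empty using (⊥-elim)
open import Function using (id; _$_)
open import Relation.Binary.PropositionalEquality using (_≢_; refl; sym; trans; cong; subst; module ≡-Reasoning)
open import Relation.Nullary using (yes; no; ¬_; contradiction)
open import Relation.Unary using (Decidable)

module _ {P : ℕ → Set} (P? : Decidable P) where

  completion-≤-or-none : (r d : ℕ) →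
    (∃ λ C → IsCompletion P r C × C ≤ r + d) ⊎ (∀ t → r < t → t ≤ r + d → ¬ P t)
  completion-≤-or-none r zero =
    inj₂ λ t r<t t≤r → ⊥-elim (<⇒≱ r<t (subst (t ≤_) (+-identityʳ r) t≤r))
  completion-≤-or-none r (suc d) with completion-≤-or-none r d
  ... | inj₁ (C , isC , C≤) = inj₁ (C , isC , ≤-trans C≤ (+-monoʳ-≤ r (n≤1+n d)))
  ... | inj₂ none with P? (r + suc d)
  ...   | yes Pt = inj₁ (r + suc d , (m<m+n r z<s , Pt , before) , ≤-refl)
    where
    before : ∀ t → r < t → t < r + suc d → ¬ P t
    before t r<t t< = none t r<t (m<1+n⇒m≤n (subst (t <_) (+-suc r d) t<))
  ...   | no ¬Pt = inj₂ none′
    where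
    none′ : ∀ t → r < t → t ≤ r + suc d → ¬ P t
    none′ t r<t t≤ with m≤n⇒m<n∨m≡n t≤
    ... | inj₁ t< = none t r<t (m<1+n⇒m≤n (subst (t <_) (+-suc r d) t<))
    ... | inj₂ refl = ¬Pt

  completion-≤ : ∀ {r T} → r < T → P T → ∃ λ C → IsCompletion P r C × C ≤ T
  completion-≤ {r} {T} r<T PT with completion-≤-or-none r (T ∸ r)
  ... | inj₁ (C , isC , C≤) = C , isC , subst (C ≤_) (m+[n∸m]≡n (<⇒≤ r<T)) C≤
  ... | inj₂ none = contradiction PT (none T r<T (≤-reflexive (sym (m+[n∸m]≡n (<⇒≤ r<T)))))

module _ (k : ℕ) where
  open ≤-Reasoning

  roundUp-≥ : (r : ℕ) → r ≤ roundUp (suc k) r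
  roundUp-≥ r = +-cancelʳ-≤ k r (suc k * q) $ begin
    r + k                       ≡⟨ m≡m%n+[m/n]*n (r + k) (suc k) ⟩
    (r + k) % suc k + q * suc k ≤⟨ +-monoˡ-≤ (q * suc k) (m<1+n⇒m≤n (m%n<n (r + k) (suc k))) ⟩
    k + q * suc k               ≡⟨ +-comm k (q * suc k) ⟩
    q * suc k + k               ≡⟨ cong (_+ k) (*-comm q (suc k)) ⟩
    suc k * q + k               ∎
    where q = (r + k) /ℕ suc k

  roundUp-≤ : (r : ℕ) → roundUp (suc k) r ≤ r + k
  roundUp-≤ r = subst (_≤ r + k) (*-comm _ (suc k)) (m/n*n≤m (r + k) (suc k))

  roundUp-mono-≤ : ∀ {r s} → r ≤ s → roundUp (suc k) r ≤ roundUp (suc k) s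
  roundUp-mono-≤ r≤s = *-monoʳ-≤ (suc k) (/-monoˡ-≤ (suc k) (+-monoˡ-≤ k r≤s))

  roundUp-divisible : (r : ℕ) → suc k ∣ roundUp (suc k) r
  roundUp-divisible r = divides ((r + k) /ℕ suc k) (*-comm (suc k) _)

flow-bound : ∀ {x y z} r {a k} → x ≤ y + suc k → y ≤ z + k → z ∸ r ≤ a →
  x ∸ r ≤ a + 2 * suc k
flow-bound {x} {y} {z} r {a} {k} x≤ y≤ z∸r≤ = m≤n+o⇒m∸n≤o x r $ begin
  x                           ≤⟨ x≤ ⟩
  y + suc k                   ≤⟨ +-monoˡ-≤ (suc k) y≤ ⟩
  z + k + suc k               ≤⟨ +-monoˡ-≤ (suc k) (+-mono-≤ (m≤n+m∸n z r) (n≤1+n k)) ⟩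
  r + (z ∸ r) + suc k + suc k ≤⟨ +-monoˡ-≤ (suc k) (+-monoˡ-≤ (suc k) (+-monoʳ-≤ r z∸r≤)) ⟩
  r + a + suc k + suc k       ≡⟨ rearrange r a (suc k) ⟩
  r + (a + 2 * suc k)         ∎
  where
  open ≤-Reasoning
  rearrange : ∀ r a n → r + a + n + n ≡ r + (a + 2 * n)
  rearrange = solve-∀

unbatching-bound : ∀ k r {C C′ i} → roundUp (suc k) r ≤ C′ → i < suc k → C ≤ suc i + C′ →
  C ∸ r ≤ (C′ ∸ roundUp (suc k) r) + 2 * suc k
unbatching-bound k r {C′ = C′} r′≤C′ i<n C≤ =
  flow-bound r (≤-trans C≤ (≤-trans (+-monoˡ-≤ C′ i<n) (≤-reflexive (+-comm (suc k) C′)))) C′≤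
             (≤-reflexive (m+n∸n≡m d r))
  where
  open ≤-Reasoning
  r′ = roundUp (suc k) r
  d = C′ ∸ r′
  C′≤ : C′ ≤ d + r + k
  C′≤ = begin
    C′           ≡⟨ m∸n+n≡m r′≤C′ ⟨
    d + r′       ≤⟨ +-monoʳ-≤ d (roundUp-≤ k r) ⟩
    d + (r + k)  ≡⟨ +-assoc d r k ⟨
    d + r + k    ∎

window : Schedule → ℕ → ℕ → List Page
window σ s n = mapMaybe (λ i → σ (s ∸ i)) (upTo n)

length-window : ∀ σ s n → length (window σ s n) ≤ n
length-window σ s n = ≤-trans (length-mapMaybe _ (upTo n)) (≤-reflexive (length-upTo n))

∈-window : ∀ σ {s n i p} → i < n → σ (s ∸ i) ≡ just p → p ∈ window σ s n
∈-window σ i<n σ[s∸i] =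
  mapMaybe⁺ _ _ (map⁺ (applyUpTo⁺ id (subst (AnyMaybe (_ ≡_)) (sym σ[s∸i]) (just-any refl)) i<n))

window-0 : ∀ σ n → Feasible σ → window σ 0 n ≡ []
window-0 σ n σ0 =
  trans (mapMaybe-cong (λ i → trans (cong σ (0∸n≡0 i)) σ0) (upTo n)) (mapMaybe-nothing (upTo n))

module Batching (k : ℕ) (σ : Schedule) where

  batched : BatchSchedule
  batched t with suc k ∣? t
  ... | yes _ = window σ (t ∸ suc k) (suc k)
  ... | no _  = []

  batched-feasible : Feasible σ → FeasibleBatch (suc k) batched
  batched-feasible σ0 = at-0 , length≤ , nonempty⇒∣
    where
    at-0 : batched 0 ≡ []
    at-0 = window-0 σ (suc k) σ0
    length≤ : ∀ t → length (batched t) ≤ suc k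
    length≤ t with suc k ∣? t
    ... | yes _ = length-window σ (t ∸ suc k) (suc k)
    ... | no _  = z≤n
    nonempty⇒∣ : ∀ t → batched t ≢ [] → suc k ∣ t
    nonempty⇒∣ t ne with suc k ∣? t
    ... | yes k∣t = k∣t
    ... | no _    = contradiction refl ne

  -- roundUp C lies in [C, C + k], so C is in the window ending there.
  ∈-batched : ∀ {p C} → Tx σ p C → BTx batched p (roundUp (suc k) C + suc k)
  ∈-batched {C = C} σC with suc k ∣? (roundUp (suc k) C + suc k)
  ... | no ∤ = contradiction (∣m∣n⇒∣m+n (roundUp-divisible k C) ∣-refl) ∤
  ... | yes _ rewrite m+n∸n≡m (roundUp (suc k) C) (suc k) =
    ∈-window σ (s≤s (m≤n+o⇒m∸n≤o _ C (roundUp-≤ k C)))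
             (trans (cong σ (m∸[m∸n]≡n (roundUp-≥ k C))) σC)

  batched-maxFlow : ∀ J L → MaxFlowAtMost (Tx σ) release J L →
    MaxFlowAtMost (BTx batched) (release' (suc k)) J (L + 2 * suc k)
  batched-maxFlow J L maxFlow ρ ρ∈J
    with C , (r<C , σC , _) , flow ← maxFlow ρ ρ∈J
    with C′ , isC′ , C′≤ ← completion-≤ (λ t → page ρ ∈? batched t)
                             (≤-<-trans (roundUp-mono-≤ k (<⇒≤ r<C)) (m<m+n _ z<s)) (∈-batched σC)
    = C′ , isC′ , ≤-trans (∸-monoʳ-≤ C′ (roundUp-≥ k (release ρ)))
                          (flow-bound (release ρ) C′≤ (roundUp-≤ k C) flow)

∈⇒≢[] : {A : Set} {x : A} {xs : List A} → x ∈ xs → xs ≢ []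
∈⇒≢[] (here _)  ()
∈⇒≢[] (there _) ()

nth : {A : Set} → List A → ℕ → Maybe A
nth []       _       = nothing
nth (x ∷ xs) zero    = just x
nth (x ∷ xs) (suc i) = nth xs i

∈⇒nth : {A : Set} {x : A} {xs : List A} → x ∈ xs → ∃ λ i → i < length xs × nth xs i ≡ just x
∈⇒nth (here refl) = 0 , z<s , refl
∈⇒nth (there x∈xs) with i , i< , nth≡ ← ∈⇒nth x∈xs = suc i , s≤s i< , nth≡

-- Slot u + 1 carries entry u % n of the batch sent at the multiple u ∸ u % n of n.
module Unbatching (k : ℕ) (τ : BatchSchedule) where

  unbatched : Schedule
  unbatched zero    = nothing
  unbatched (suc u) = nth (τ (u ∸ u % suc k)) (u % suc k)

  Tx-unbatched : ∀ {p i C′} → suc k ∣ C′ → i < suc k → nth (τ C′) i ≡ just p →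
    Tx unbatched p (suc i + C′)
  Tx-unbatched {p} {i} (divides m refl) i<n nth≡ = begin
    nth (τ (u ∸ u % suc k)) (u % suc k) ≡⟨ cong (λ j → nth (τ (u ∸ j)) j) u%n≡i ⟩
    nth (τ (u ∸ i)) i                   ≡⟨ cong (λ t → nth (τ t) i) (m+n∸m≡n i (m * suc k)) ⟩
    nth (τ (m * suc k)) i               ≡⟨ nth≡ ⟩
    just p                              ∎
    where
    open ≡-Reasoning
    u = i + m * suc k
    u%n≡i : u % suc k ≡ i
    u%n≡i = trans ([m+kn]%n≡m%n i m (suc k)) (m<n⇒m%n≡m i<n)

  unbatched-delay : FeasibleBatch (suc k) τ → ∀ ρ C′ →
    IsCompletion (BTx τ (page ρ)) (release' (suc k) ρ) C′ →
    ∃ λ C → IsCompletion (Tx unbatched (page ρ)) (release ρ) C ×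
      (C ∸ release ρ ≤ (C′ ∸ release' (suc k) ρ) + 2 * suc k)
  unbatched-delay (_ , length≤ , nonempty⇒∣) ρ C′ (r′<C′ , p∈τC′ , _)
    with i , i<len , nth≡ ← ∈⇒nth p∈τC′
    with i<n ← ≤-trans i<len (length≤ C′)
    with C , isC , C≤ ← completion-≤ (λ t → Maybe.≡-dec _≟_ (unbatched t) (just (page ρ)))
                          (s≤s (≤-trans (≤-trans (roundUp-≥ k (release ρ)) (<⇒≤ r′<C′)) (m≤n+m C′ i)))
                          (Tx-unbatched (nonempty⇒∣ C′ (∈⇒≢[] p∈τC′)) i<n nth≡)
    = C , isC , unbatching-bound k (release ρ) (<⇒≤ r′<C′) i<n C≤

-- Only ε L* = k > 0 matters.
lemma2 : (J : Instance) (L* : ℕ) → IsOptimalMaxFlow J L* →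
    (ε : ℚ) → 0ℚ <ℚ ε → (k : ℕ) → 0 < k → ε *ℚ ((+ L*) / 1) ≡ (+ k) / 1 →
    (∃ λ τ → FeasibleBatch k τ × MaxFlowAtMost (BTx τ) (release' k) J (L* + 2 * k))
    ×
    ((τ : BatchSchedule) → FeasibleBatch k τ →
      ∃ λ σ → Feasible σ ×
        ((ρ : Request) → ρ ∈ J → (C' : ℕ) →
          IsCompletion (BTx τ (page ρ)) (release' k ρ) C' →
          ∃ λ C → IsCompletion (Tx σ (page ρ)) (release ρ) C ×
            (C ∸ release ρ ≤ (C' ∸ release' k ρ) + 2 * k)))
lemma2 J L* ((σ , σ-feasible , σ-maxFlow) , _) _ _ (suc k) _ _ =
  (batched , batched-feasible σ-feasible , batched-maxFlow J L* σ-maxFlow) ,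
  λ τ τ-feasible → let open Unbatching k τ in
    unbatched , refl , λ ρ _ → unbatched-delay τ-feasible ρ
  where open Batching k σ
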